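{- Let $k\ge 0$ be an integer, let $P$ be a finite propositional logic program and let $M$ be a stable model of $P$ with $|M|\le k$. For $q\in M$ let $s_q$ be the least integer $s\ge1$ with $q\in T^s_{P^M}(\emptyset)$. Then the set $U_M=\{c(q),c(q,s_q)\colon q\in M\}\cup\{c^-(q,i)\colon q\in M,\ s_q<i\le k+1\}$ is a model of the theory $T_0(P)$.
   Context: A logic program is a finite set of rules $r$ of the form $q \leftarrow a_1,\ldots,a_s,\mathbf{not}(b_1),\ldots,\mathbf{not}(b_t)$ with $q,a_i,b_j$ propositional atoms; $\mathrm{At}(P)$ is the set of atoms of $P$. For $M\subseteq\mathrm{At}(P)$ the reduct $P^M$ deletes every rule having some $b_j\in M$ and deletes negated atoms from the remaining rules; $M$ is a stable model if $M$ equals the least model of $P^M$. For a Horn program $H$, $T_H(X)=\{a\colon a\leftarrow b_1,\ldots,b_s\in H,\ \{b_1,\ldots,b_s\}\subseteq X\}$, $T^0_H(\emptyset)=\emptyset$, $T^{i+1}_H(\emptyset)=T_H(T^i_H(\emptyset))$. Fix $k$. For each $q\in\mathrm{At}(P)$ introduce new propositional atoms $c(q)$, $c(q,i)$ ($1\le i\le k+1$), $c^-(q,i)$ ($2\le i\le k+1$). Let $F_1(q,i)$ ($2\le i\le k+1$) be $c^-(q,i)\Leftrightarrow c(q,1)\vee\cdots\vee c(q,i-1)$, and $F_2(q)$ be $c(q)\Leftrightarrow c(q,1)\vee\cdots\vee c(q,k+1)$. For a rule $r=q\leftarrow a_1,\ldots,a_s,\mathbf{not}(b_1),\ldots,\mathbf{not}(b_t)$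 and $2\le i\le k+1$, $F_3(r,i)=c^-(a_1,i)\wedge\cdots\wedge c^-(a_s,i)\wedge\neg c(b_1)\wedge\cdots\wedge\neg c(b_t)\wedge\neg c^-(q,i)$; $F_3(r,1)$ is $\mathbf{false}$ if $s\ge1$ and is $\neg c(b_1)\wedge\cdots\wedge\neg c(b_t)$ if $s=0$. For $q\in\mathrm{At}(P)$ with $r_1,\ldots,r_v$ all rules of $P$ with head $q$, and $1\le i\le k+1$, $F_4(q,i)$ is $c(q,i)\Leftrightarrow F_3(r_1,i)\vee\cdots\vee F_3(r_v,i)$ (empty disjunction is false). $T_0(P)=\{F_1(q,i)\colon q\in\mathrm{At}(P),2\le i\le k+1\}\cup\{F_2(q)\colon q\in\mathrm{At}(P)\}\cup\{F_4(q,i)\colon q\in\mathrm{At}(P),1\le i\le k+1\}$. A set of atoms $U$ is a model if the valuation making exactly the atoms of $U$ true satisfies every formula. -}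

module Defs where

open import Data.Nat using (ℕ; zero; suc; _≤_; _<_; _≟_)
open import Data.List using (List; []; _∷_; map; foldr; filter; upTo; length)
open import Data.List.Membership.Propositional using (_∈_; _∉_)
open import Data.List.Membership.DecPropositional _≟_ using (_∈?_)
open import Data.List.Relation.Unary.All using (All; all?)
open import Data.Product using (Σ; _×_; _,_; ∃)
open import Data.Sum using (_⊎_)
open import Data.Empty using (⊥)
open import Data.Unit using (⊤)
open import Relation.Nullary using (¬_; ¬?)
open import Relation.Binary.PropositionalEquality using (_≡_)
open import Level using (Level; _⊔_) renaming (suc to lsuc)

Atom : Set
Atom = ℕ

record Rule : Set where
  constructor _←_∣_
  field
    head : Atom
    pos  : List Atom
    neg  : List Atom
open Rule public

Program : Set
Program = List Rule

_∈At_ : Atom → Program → Set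
q ∈At P = Σ Rule λ r → r ∈ P × (q ≡ head r ⊎ q ∈ pos r ⊎ q ∈ neg r)

record HornRule : Set where
  constructor _⇐_
  field
    hhead : Atom
    hbody : List Atom
open HornRule public

HornProgram : Set
HornProgram = List HornRule

reduct : Program → List Atom → HornProgram
reduct P M = map (λ r → head r ⇐ pos r)
                 (filter (λ r → all? (λ b → ¬? (b ∈? M)) (neg r)) P)

ASet : Set₁
ASet = Atom → Set

IsModelH : HornProgram → ASet → Set
IsModelH H X = ∀ r → r ∈ H → All X (hbody r) → X (hhead r)

IsLeastModel : HornProgram → ASet → Set₁
IsLeastModel H X = IsModelH H X × (∀ (Y : ASet) → IsModelH H Y → ∀ a → X a → Y a)

IsStableModel : Program → List Atom → Set₁
IsStableModel P M = (∀ a → a ∈ M → a ∈At P) × IsLeastModel (reduct P M) (λ a → a ∈ M)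

T : HornProgram → ASet → ASet
T H X a = Σ HornRule λ r → r ∈ H × hhead r ≡ a × All X (hbody r)

Titer : HornProgram → ℕ → ASet
Titer H zero    = λ _ → ⊥
Titer H (suc i) = T H (Titer H i)

IsLeastStage : HornProgram → Atom → ℕ → Set
IsLeastStage H q s = 1 ≤ s × Titer H s q × (∀ s' → 1 ≤ s' → s' < s → ¬ Titer H s' q)

data NAtom : Set where
  c   : Atom → NAtom
  cI  : Atom → ℕ → NAtom
  cM  : Atom → ℕ → NAtom

data Formula : Set where
  atom  : NAtom → Formula
  true  : Formula
  false : Formula
  ~_    : Formula → Formula
  _∧'_  : Formula → Formula → Formula
  _∨'_  : Formula → Formula → Formula
  _⇔_   : Formula → Formula → Formula

⋀ : List Formula → Formula
⋀ = foldr _∧'_ true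

⋁ : List Formula → Formula
⋁ = foldr _∨'_ false

Sat : (NAtom → Set) → Formula → Set
Sat U (atom x) = U x
Sat U true     = ⊤
Sat U false    = ⊥
Sat U (~ φ)    = ¬ Sat U φ
Sat U (φ ∧' ψ) = Sat U φ × Sat U ψ
Sat U (φ ∨' ψ) = Sat U φ ⊎ Sat U ψ
Sat U (φ ⇔ ψ)  = (Sat U φ → Sat U ψ) × (Sat U ψ → Sat U φ)

oneTo : ℕ → List ℕ
oneTo n = map suc (upTo n)

module _ (k : ℕ) where

  F1 : Atom → ℕ → Formula
  F1 q i = atom (cM q i) ⇔ ⋁ (map (λ j → atom (cI q j)) (oneTo (Data.Nat._∸_ i 1)))

  F2 : Atom → Formula
  F2 q = atom (c q) ⇔ ⋁ (map (λ j → atom (cI q j)) (oneTo (suc k)))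

  F3 : Rule → ℕ → Formula
  F3 r (suc zero) with pos r
  ... | []    = ⋀ (map (λ b → ~ atom (c b)) (neg r))
  ... | _ ∷ _ = false
  F3 r i = ⋀ (map (λ a → atom (cM a i)) (pos r))
           ∧' (⋀ (map (λ b → ~ atom (c b)) (neg r))
           ∧' (~ atom (cM (head r) i)))

  rulesWithHead : Program → Atom → List Rule
  rulesWithHead P q = filter (λ r → head r ≟ q) P

  F4 : Program → Atom → ℕ → Formula
  F4 P q i = atom (cI q i) ⇔ ⋁ (map (λ r → F3 r i) (rulesWithHead P q))

  data T0 (P : Program) : Formula → Set where
    inF1 : ∀ q i → q ∈At P → 2 ≤ i → i ≤ suc k → T0 P (F1 q i)
    inF2 : ∀ q → q ∈At P → T0 P (F2 q)
    inF4 : ∀ q i → q ∈At P → 1 ≤ i → i ≤ suc k → T0 P (F4 P q i)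

  U_M : Program → List Atom → NAtom → Set
  U_M P M (c q)    = q ∈ M
  U_M P M (cI q i) = q ∈ M × IsLeastStage (reduct P M) q i
  U_M P M (cM q i) = q ∈ M × Σ ℕ λ s → IsLeastStage (reduct P M) q s × s < i × i ≤ suc k

IsModelOf : (NAtom → Set) → (Formula → Set) → Set
IsModelOf U Th = ∀ φ → Th φ → Sat U φ

-- The iterates T^i of the reduct H = P^M form an increasing chain inside the least model M;
-- as long as it has not reached M it gains an atom of M at every step (a stalled chain is
-- already a model of H, hence contains M).  So every q ∈ M has a least stage s_q ≤ |M| ≤ k.
-- Under U_M, c⁻(a,i) then says exactly a ∈ T^(i-1), and F₃(r,i) says that the body of the
-- reduct rule of r holds in T^(i-1) while its head does not; hence F₄(q,i) reads
-- "s_q = i iff q is first derived at stage i", while F₁ and F₂ merely express that s_q is a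
-- single stage in the range 1, …, k+1.
module Submission where

open import Defs
open import Data.Nat using (ℕ; zero; suc; _≤_; _<_; _≟_; z≤n; s≤s)
open import Data.Nat.Properties using (≤-refl; ≤-trans; ≤-pred; n≤1+n; m≤n⇒m≤1+n; <⇒≱)
open import Data.List using (List; []; _∷_; map; filter; length)
open import Data.List.Properties using (filter-accept; filter-reject; filter-notAll)
open import Data.List.Membership.Propositional using (_∈_; _∉_; find; lose)
open import Data.List.Membership.Propositional.Properties
  using (∈-map⁺; ∈-map⁻; ∈-filter⁺; ∈-filter⁻; ∈-upTo⁺; ∈-upTo⁻)
open import Data.List.Relation.Unary.All as All using (All; []; _∷_; all?)
open import Data.List.Relation.Unary.All.Properties using (¬All⇒Any¬)
open import Data.List.Membership.DecPropositional _≟_ using (_∈?_)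
open import Data.List.Relation.Unary.Any using (Any; here; there; any?; satisfied)
open import Data.List.Relation.Binary.Sublist.Propositional using (⊆-refl)
open import Data.List.Relation.Binary.Sublist.Propositional.Properties using (filter⁺; length-mono-≤)
open import Data.List.Relation.Unary.Unique.Propositional using (Unique)
open import Data.Product using (_×_; _,_; proj₁; proj₂; ∃-syntax)
open import Data.Sum using (_⊎_; inj₁; inj₂)
open import Data.Empty using (⊥-elim)
open import Data.Unit using (tt)
open import Function using (_∘_)
open import Relation.Nullary using (¬_; ¬?; yes; no)
open import Relation.Nullary.Decidable using (_×-dec_; map′; decidable-stable)
open import Relation.Unary using (Decidable; _⊆_)
open import Relation.Binary.PropositionalEquality using (_≡_; refl)

module _ (U : NAtom → Set) {A : Set} (f : A → Formula) where

  Sat-⋁⁻ : ∀ xs → Sat U (⋁ (map f xs)) → Any (Sat U ∘ f) xs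
  Sat-⋁⁻ []       ()
  Sat-⋁⁻ (x ∷ xs) (inj₁ s) = here s
  Sat-⋁⁻ (x ∷ xs) (inj₂ s) = there (Sat-⋁⁻ xs s)

  Sat-⋁⁺ : ∀ {xs} → Any (Sat U ∘ f) xs → Sat U (⋁ (map f xs))
  Sat-⋁⁺ (here s)  = inj₁ s
  Sat-⋁⁺ (there s) = inj₂ (Sat-⋁⁺ s)

  Sat-⋀⁻ : ∀ xs → Sat U (⋀ (map f xs)) → All (Sat U ∘ f) xs
  Sat-⋀⁻ []       _        = []
  Sat-⋀⁻ (x ∷ xs) (s , ss) = s ∷ Sat-⋀⁻ xs ss

  Sat-⋀⁺ : ∀ {xs} → All (Sat U ∘ f) xs → Sat U (⋀ (map f xs))
  Sat-⋀⁺ []       = tt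
  Sat-⋀⁺ (s ∷ ss) = s , Sat-⋀⁺ ss

∈-oneTo⁻ : ∀ {j n} → j ∈ oneTo n → 1 ≤ j × j ≤ n
∈-oneTo⁻ j∈ with ∈-map⁻ suc j∈
... | _ , x∈ , refl = s≤s z≤n , ∈-upTo⁻ x∈

∈-oneTo⁺ : ∀ {j n} → 1 ≤ j → j ≤ n → j ∈ oneTo n
∈-oneTo⁺ {suc j} _ j≤n = ∈-map⁺ suc (∈-upTo⁺ j≤n)

module _ {A : Set} {P Q : A → Set} (P? : Decidable P) (Q? : Decidable Q) (P⊆Q : P ⊆ Q) where

  length-filter-mono : ∀ xs → length (filter P? xs) ≤ length (filter Q? xs)
  length-filter-mono xs = length-mono-≤ (filter⁺ P? Q? (λ { refl → P⊆Q }) (⊆-refl {x = xs}))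

  length-filter-strictMono : ∀ {xs} → Any (λ a → Q a × ¬ P a) xs →
                             length (filter P? xs) < length (filter Q? xs)
  length-filter-strictMono {a ∷ as} (here (qa , ¬pa))
    rewrite filter-reject P? {a} {as} ¬pa | filter-accept Q? {a} {as} qa = s≤s (length-filter-mono as)
  length-filter-strictMono {a ∷ as} (there new) with P? a | Q? a
  ... | yes _  | yes _  = s≤s (length-filter-strictMono new)
  ... | yes pa | no ¬qa = ⊥-elim (¬qa (P⊆Q pa))
  ... | no _   | yes _  = m≤n⇒m≤1+n (length-filter-strictMono new)
  ... | no _   | no _   = length-filter-strictMono new

length-filter-complete : ∀ {A : Set} {P : A → Set} (P? : Decidable P) xs →
                         length xs ≤ length (filter P? xs) → All P xs
length-filter-complete P? xs n≤ =
  decidable-stable (all? P? xs) λ ¬all → <⇒≱ (filter-notAll P? xs (¬All⇒Any¬ P? xs ¬all)) n≤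

module HornIteration (H : HornProgram) where

  Titer? : ∀ i → Decidable (Titer H i)
  Titer? zero    a = no λ ()
  Titer? (suc i) a =
    map′ find (λ (r , r∈ , fires) → lose r∈ fires)
         (any? (λ r → (hhead r ≟ a) ×-dec all? (Titer? i) (hbody r)) H)

  Titer-mono : ∀ {i j} → i ≤ j → Titer H i ⊆ Titer H j
  Titer-mono (s≤s i≤j) (r , r∈ , e , body) = r , r∈ , e , All.map (Titer-mono i≤j) body

  Titer-step : ∀ i → Titer H i ⊆ Titer H (suc i)
  Titer-step i = Titer-mono (n≤1+n i)

  Titer⊆model : ∀ X {i} → IsModelH H X → Titer H i ⊆ X
  Titer⊆model X {suc i} isModel (r , r∈ , refl , body) =
    isModel r r∈ (All.map (Titer⊆model X {i} isModel) body)

  Titer-closed⇒model : ∀ {i} → Titer H (suc i) ⊆ Titer H i → IsModelH H (Titer H i)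
  Titer-closed⇒model closed r r∈ body = closed (r , r∈ , refl , body)

  leastStage-suc⁺ : ∀ {q m} → Titer H (suc m) q → ¬ Titer H m q → IsLeastStage H q (suc m)
  leastStage-suc⁺ t ¬t = s≤s z≤n , t , λ s _ s<1+m t′ → ¬t (Titer-mono (≤-pred s<1+m) t′)

  leastStage-suc⁻ : ∀ {q m} → IsLeastStage H q (suc m) → ¬ Titer H m q
  leastStage-suc⁻ {m = zero}  _               ()
  leastStage-suc⁻ {m = suc m} (_ , _ , first) = first (suc m) (s≤s z≤n) ≤-refl

  leastStage-exists : ∀ {q n} → Titer H n q → ∃[ s ] IsLeastStage H q s × s ≤ n
  leastStage-exists {q} {suc m} t with Titer? m q
  ... | yes t′ = let s , least , s≤m = leastStage-exists t′ in s , least , m≤n⇒m≤1+n s≤m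
  ... | no ¬t′ = suc m , leastStage-suc⁺ t ¬t′ , ≤-refl

  module _ {M : List Atom} (least : IsLeastModel H (_∈ M)) where

    stalled⇒covers : ∀ i → ¬ Any (λ a → Titer H (suc i) a × ¬ Titer H i a) M → All (Titer H i) M
    stalled⇒covers i ¬new = All.tabulate λ {a} → proj₂ least (Titer H i) (Titer-closed⇒model {i} closed) a
      where
      closed : Titer H (suc i) ⊆ Titer H i
      closed {a} t = decidable-stable (Titer? i a) λ ¬t →
        ¬new (lose (Titer⊆model (_∈ M) {suc i} (proj₁ least) t) (t , ¬t))

    Titer-covers-or-grows : ∀ i → All (Titer H i) M ⊎ i ≤ length (filter (Titer? i) M)
    Titer-covers-or-grows zero = inj₂ z≤n
    Titer-covers-or-grows (suc i) with Titer-covers-or-grows i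
    ... | inj₁ covers = inj₁ (All.map (Titer-step i) covers)
    ... | inj₂ i≤ with any? (λ a → Titer? (suc i) a ×-dec ¬? (Titer? i a)) M
    ...   | yes new =
      inj₂ (≤-trans (s≤s i≤) (length-filter-strictMono (Titer? i) (Titer? (suc i)) (Titer-step i) new))
    ...   | no ¬new = inj₁ (All.map (Titer-step i) (stalled⇒covers i ¬new))

    leastModel⊆Titer-length : All (Titer H (length M)) M
    leastModel⊆Titer-length with Titer-covers-or-grows (length M)
    ... | inj₁ covers = covers
    ... | inj₂ n≤     = length-filter-complete (Titer? (length M)) M n≤

    leastStage-≤-length : ∀ {q} → q ∈ M → ∃[ s ] IsLeastStage H q s × s ≤ length M
    leastStage-≤-length q∈M = leastStage-exists (All.lookup leastModel⊆Titer-length q∈M)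

module _ (P : Program) (M : List Atom) where

  private
    survives? : Decidable (λ r → All (_∉ M) (neg r))
    survives? r = all? (λ b → ¬? (b ∈? M)) (neg r)

  ∈-reduct⁻ : ∀ {hr} → hr ∈ reduct P M →
              ∃[ r ] r ∈ P × All (_∉ M) (neg r) × hr ≡ (head r ⇐ pos r)
  ∈-reduct⁻ hr∈ with ∈-map⁻ _ hr∈
  ... | r , r∈ , refl = let r∈P , negsOut = ∈-filter⁻ survives? r∈ in r , r∈P , negsOut , refl

  ∈-reduct⁺ : ∀ {r} → r ∈ P → All (_∉ M) (neg r) → (head r ⇐ pos r) ∈ reduct P M
  ∈-reduct⁺ r∈P negsOut = ∈-map⁺ (λ r → head r ⇐ pos r) (∈-filter⁺ survives? r∈P negsOut)

module _ {k : ℕ} {P : Program} {q : Atom} where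

  ∈-rulesWithHead⁻ : ∀ {r} → r ∈ rulesWithHead k P q → r ∈ P × head r ≡ q
  ∈-rulesWithHead⁻ = ∈-filter⁻ (λ r → head r ≟ q)

  ∈-rulesWithHead⁺ : ∀ {r} → r ∈ P → head r ≡ q → r ∈ rulesWithHead k P q
  ∈-rulesWithHead⁺ = ∈-filter⁺ (λ r → head r ≟ q)

module StableModelTranslation (k : ℕ) (P : Program) (M : List Atom)
                              (|M|≤k : length M ≤ k) (stable : IsStableModel P M) where

  private
    H = reduct P M
    U = U_M k P M
    least = proj₂ stable
  open HornIteration H

  Titer⊆M : ∀ i → Titer H i ⊆ (_∈ M)
  Titer⊆M i = Titer⊆model (_∈ M) {i} (proj₁ least)

  cM-sound : ∀ {a m} → U (cM a (suc m)) → Titer H m a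
  cM-sound (_ , s , (_ , t , _) , s<1+m , _) = Titer-mono (≤-pred s<1+m) t

  cM-complete : ∀ {a m} → suc m ≤ suc k → Titer H m a → U (cM a (suc m))
  cM-complete {m = m} i≤ t =
    let s , leastStage , s≤m = leastStage-exists t in Titer⊆M m t , s , leastStage , s≤s s≤m , i≤

  -- F₃(r,1) is defined separately, but as T^0 = ∅ it satisfies the same characterisation.
  F3-sound : ∀ {m} r → suc m ≤ suc k → Sat U (F3 k r (suc m)) →
             All (Titer H m) (pos r) × All (_∉ M) (neg r) × ¬ Titer H m (head r)
  F3-sound {zero}  (h ← []      ∣ ns) _  negsOut = [] , Sat-⋀⁻ U (λ b → ~ atom (c b)) ns negsOut , λ ()
  F3-sound {zero}  (h ← (_ ∷ _) ∣ ns) _  ()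
  F3-sound {suc m} r                  i≤ (posIn , negsOut , headOut) =
    All.map cM-sound (Sat-⋀⁻ U (λ a → atom (cM a (suc (suc m)))) (pos r) posIn) ,
    Sat-⋀⁻ U (λ b → ~ atom (c b)) (neg r) negsOut ,
    headOut ∘ cM-complete i≤

  F3-complete : ∀ {m} r → suc m ≤ suc k → All (Titer H m) (pos r) → All (_∉ M) (neg r) →
                ¬ Titer H m (head r) → Sat U (F3 k r (suc m))
  F3-complete {zero}  (h ← []      ∣ ns) _  []       negsOut _ = Sat-⋀⁺ U (λ b → ~ atom (c b)) negsOut
  F3-complete {zero}  (h ← (_ ∷ _) ∣ ns) _  (() ∷ _) _       _
  F3-complete {suc m} r                  i≤ posIn    negsOut headOut =
    Sat-⋀⁺ U (λ a → atom (cM a (suc (suc m)))) (All.map (cM-complete i≤) posIn) ,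
    Sat-⋀⁺ U (λ b → ~ atom (c b)) negsOut ,
    headOut ∘ cM-sound

  F1-holds : ∀ q i → 2 ≤ i → i ≤ suc k → Sat U (F1 k q i)
  F1-holds q (suc (suc m)) (s≤s (s≤s z≤n)) i≤ = fwd , bwd
    where
    fwd : U (cM q (suc (suc m))) → Sat U (⋁ (map (λ j → atom (cI q j)) (oneTo (suc m))))
    fwd (q∈M , s , leastStage , s<i , _) =
      Sat-⋁⁺ U (λ j → atom (cI q j)) (lose (∈-oneTo⁺ (proj₁ leastStage) (≤-pred s<i)) (q∈M , leastStage))

    bwd : Sat U (⋁ (map (λ j → atom (cI q j)) (oneTo (suc m)))) → U (cM q (suc (suc m)))
    bwd earlier with find (Sat-⋁⁻ U (λ j → atom (cI q j)) (oneTo (suc m)) earlier)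
    ... | j , j∈ , q∈M , leastStage = q∈M , j , leastStage , s≤s (proj₂ (∈-oneTo⁻ j∈)) , i≤

  F2-holds : ∀ q → Sat U (F2 k q)
  F2-holds q = fwd , bwd
    where
    fwd : q ∈ M → Sat U (⋁ (map (λ j → atom (cI q j)) (oneTo (suc k))))
    fwd q∈M =
      let s , leastStage , s≤|M| = leastStage-≤-length least q∈M
          s≤1+k = ≤-trans s≤|M| (≤-trans |M|≤k (n≤1+n k))
      in Sat-⋁⁺ U (λ j → atom (cI q j)) (lose (∈-oneTo⁺ (proj₁ leastStage) s≤1+k) (q∈M , leastStage))

    bwd : Sat U (⋁ (map (λ j → atom (cI q j)) (oneTo (suc k)))) → q ∈ M
    bwd some = proj₁ (proj₂ (satisfied (Sat-⋁⁻ U (λ j → atom (cI q j)) (oneTo (suc k)) some)))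

  F4-holds : ∀ q m → suc m ≤ suc k → Sat U (F4 k P q (suc m))
  F4-holds q m i≤ = fwd , bwd
    where
    fwd : U (cI q (suc m)) → Sat U (⋁ (map (λ r → F3 k r (suc m)) (rulesWithHead k P q)))
    fwd (_ , leastStage@(_ , (hr , hr∈ , refl , posIn) , _)) with ∈-reduct⁻ P M hr∈
    ... | r , r∈P , negsOut , refl =
      Sat-⋁⁺ U (λ r → F3 k r (suc m)) (lose (∈-rulesWithHead⁺ {k = k} r∈P refl)
        (F3-complete r i≤ posIn negsOut (leastStage-suc⁻ leastStage)))

    bwd : Sat U (⋁ (map (λ r → F3 k r (suc m)) (rulesWithHead k P q))) → U (cI q (suc m))
    bwd some with find (Sat-⋁⁻ U (λ r → F3 k r (suc m)) (rulesWithHead k P q) some)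
    ... | r , r∈ , fires with ∈-rulesWithHead⁻ {k = k} {q = q} r∈ | F3-sound r i≤ fires
    ...   | r∈P , refl | posIn , negsOut , headOut = Titer⊆M (suc m) t , leastStage-suc⁺ t headOut
      where
      t : Titer H (suc m) (head r)
      t = (head r ⇐ pos r) , ∈-reduct⁺ P M r∈P negsOut , refl , posIn

mainTheorem9 : (k : ℕ) (P : Program) (M : List Atom) →
    Unique M → length M ≤ k → IsStableModel P M →
    IsModelOf (U_M k P M) (T0 k P)
mainTheorem9 k P M _ |M|≤k stable = satisfies
  where
  open StableModelTranslation k P M |M|≤k stable

  satisfies : IsModelOf (U_M k P M) (T0 k P)
  satisfies _ (inF1 q i _ 2≤i i≤)     = F1-holds q i 2≤i i≤
  satisfies _ (inF2 q _)              = F2-holds q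
  satisfies _ (inF4 q (suc m) _ _ i≤) = F4-holds q m i≤
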